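{- Let $R$ be a root system of type $A_n$, $B_n$, $C_n$, $D_n$, $F_4$, $E_6$, $E_7$ or $E_8$ (type $G_2$ excluded). Let $G$ be the root lattice, i.e. the additive abelian group generated by the roots in $R$, and let $S\subseteq R$ satisfy $-S=S$. Then the Cayley graph $\mathrm{Cayley}(G,S)$ is Ricci-flat.
   Context: $\mathrm{Cayley}(G,S)$ has vertex set $G$, with $x\sim y$ iff $y-x\in S$. For a vertex $x$ let $\Gamma(x)$ be its neighbors, $d_x=|\Gamma(x)|$, and $d$ the graph distance. For $\alpha\in[0,1]$ let $m_x^\alpha(x)=\alpha$, $m_x^\alpha(v)=\frac{1-\alpha}{d_x}$ for $v\in\Gamma(x)$, $0$ otherwise. $W(m_1,m_2)=\inf_A\sum A(x,y)d(x,y)$ over couplings $A$ of $m_1,m_2$. $\kappa_\alpha(x,y)=1-\frac{W(m_x^\alpha,m_y^\alpha)}{d(x,y)}$, $\kappa(x,y)=\lim_{\alpha\to1}\frac{\kappa_\alpha(x,y)}{1-\alpha}$. A graph is Ricci-flat if $\kappa(x,y)=0$ for every edge $xy$.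
   Formalization: The parameter α, the tolerances in the limit defining $\kappa(x,y)$, and the values of the couplings A are all taken in the rationals. -}

module Defs where

open import Data.Nat as ℕ using (ℕ; zero; suc)
open import Data.Integer as ℤ using (ℤ; +_; -1ℤ)
open import Data.Fin using (Fin; zero; suc)
open import Data.Vec as Vec using (Vec; []; _∷_; lookup; zipWith)
open import Data.List as List using (List; length)
open import Data.List.Membership.Propositional using (_∈_)
open import Data.Rational as ℚ using (ℚ; 0ℚ; 1ℚ; _/_)
open import Data.Bool using (if_then_else_)
open import Data.Product using (Σ; ∃; ∃₂; _×_; _,_)
open import Data.Sum using (_⊎_)
open import Relation.Binary.PropositionalEquality using (_≡_; _≢_)
open import Relation.Nullary using (¬_)
open import Relation.Nullary.Decidable using (⌊_⌋)

-- Points of the ambient lattice ℤ^m (roots are realised in standard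
-- coordinates; for F4, E6, E7, E8 all coordinates are doubled so that
-- they become integers -- a group isomorphism, irrelevant for Cayley graphs)

Pt : ℕ → Set
Pt m = Vec ℤ m

_⊕_ : ∀ {m} → Pt m → Pt m → Pt m
_⊕_ = zipWith ℤ._+_

⊖_ : ∀ {m} → Pt m → Pt m
⊖ v = Vec.map (λ z → ℤ.- z) v

𝟎 : ∀ {m} → Pt m
𝟎 = Vec.replicate _ (+ 0)

_·_ : ∀ {m} → ℤ → Pt m → Pt m
c · v = Vec.map (c ℤ.*_) v

e : ∀ {m} → Fin m → Pt m
e {suc m} zero = + 1 ∷ 𝟎
e {suc m} (suc i) = + 0 ∷ e i

dot : ∀ {m} → Pt m → Pt m → ℤ
dot u v = Vec.foldr _ ℤ._+_ (+ 0) (zipWith ℤ._*_ u v)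

IsSign : ℤ → Set
IsSign σ = σ ≡ + 1 ⊎ σ ≡ -1ℤ

OneTerm : ∀ {m} → ℤ → Pt m → Set
OneTerm c v = ∃₂ λ i σ → IsSign σ × v ≡ (σ ℤ.* c) · e i

TwoTerm : ∀ {m} → ℤ → Pt m → Set
TwoTerm c v = ∃₂ λ i j → i ≢ j × ∃₂ λ σ τ → IsSign σ × IsSign τ ×
  v ≡ ((σ ℤ.* c) · e i) ⊕ ((τ ℤ.* c) · e j)

AllSigns : ∀ {m} → Pt m → Set
AllSigns {m} v = ∀ (k : Fin m) → IsSign (lookup v k)

negCount : ∀ {m} → Pt m → ℕ
negCount [] = 0
negCount (x ∷ v) = (if ⌊ x ℤ.≟ -1ℤ ⌋ then 1 else 0) ℕ.+ negCount v

EvenNegs : ∀ {m} → Pt m → Set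
EvenNegs v = ∃ λ k → negCount v ≡ 2 ℕ.* k

data RootType : Set where
  Aₙ Bₙ Cₙ Dₙ : ℕ → RootType
  F4 E6 E7 E8 : RootType

-- Bourbaki ranges: A_n (n≥1), B_n (n≥2), C_n (n≥3), D_n (n≥4)
ValidType : RootType → Set
ValidType (Aₙ n) = 1 ℕ.≤ n
ValidType (Bₙ n) = 2 ℕ.≤ n
ValidType (Cₙ n) = 3 ℕ.≤ n
ValidType (Dₙ n) = 4 ℕ.≤ n
ValidType F4 = 1 ℕ.≤ 1
ValidType E6 = 1 ℕ.≤ 1
ValidType E7 = 1 ℕ.≤ 1
ValidType E8 = 1 ℕ.≤ 1

dim : RootType → ℕ
dim (Aₙ n) = suc n
dim (Bₙ n) = n
dim (Cₙ n) = n
dim (Dₙ n) = n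
dim F4 = 4
dim E6 = 8
dim E7 = 8
dim E8 = 8

-- E8 (doubled coordinates): ±e_i±e_j and ½(±1,…,±1) with an even number of minus signs
IsRootE8 : Pt 8 → Set
IsRootE8 v = TwoTerm (+ 2) v ⊎ (AllSigns v × EvenNegs v)

-- a = e7 + e8 and b = e6 - e7 are roots of E8 with ⟨a,b⟩ = -1 (they span an A2).
-- E7 = roots of E8 orthogonal to a;  E6 = roots of E8 orthogonal to a and b.
rootA : Pt 8
rootA = + 0 ∷ + 0 ∷ + 0 ∷ + 0 ∷ + 0 ∷ + 0 ∷ + 2 ∷ + 2 ∷ []

rootB : Pt 8
rootB = + 0 ∷ + 0 ∷ + 0 ∷ + 0 ∷ + 0 ∷ + 2 ∷ ℤ.- (+ 2) ∷ + 0 ∷ []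

IsRoot : (t : RootType) → Pt (dim t) → Set
IsRoot (Aₙ n) v = ∃₂ λ i j → i ≢ j × v ≡ e i ⊕ (⊖ e j)
IsRoot (Bₙ n) v = OneTerm (+ 1) v ⊎ TwoTerm (+ 1) v
IsRoot (Cₙ n) v = OneTerm (+ 2) v ⊎ TwoTerm (+ 1) v
IsRoot (Dₙ n) v = TwoTerm (+ 1) v
IsRoot F4 v = OneTerm (+ 2) v ⊎ TwoTerm (+ 2) v ⊎ AllSigns v
IsRoot E6 v = IsRootE8 v × dot v rootA ≡ + 0 × dot v rootB ≡ + 0
IsRoot E7 v = IsRootE8 v × dot v rootA ≡ + 0
IsRoot E8 v = IsRootE8 v

data InLattice {m} (P : Pt m → Set) : Pt m → Set where
  lat0 : InLattice P 𝟎
  lat+ : ∀ {r v} → P r → InLattice P v → InLattice P (r ⊕ v)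
  lat- : ∀ {r v} → P r → InLattice P v → InLattice P ((⊖ r) ⊕ v)

-- Cayley graph Cayley(G,S): x ~ y iff y - x ∈ S, i.e. y = x ⊕ s, s ∈ S.

data Walk {m} (S : List (Pt m)) : Pt m → Pt m → ℕ → Set where
  here : ∀ {u} → Walk S u u 0
  step : ∀ {u v k s} → s ∈ S → Walk S (u ⊕ s) v k → Walk S u v (suc k)

IsDist : ∀ {m} → List (Pt m) → Pt m → Pt m → ℕ → Set
IsDist S u v k = Walk S u v k × (∀ j → j ℕ.< k → ¬ Walk S u v j)

-- The measures m_x^α, indexed by Fin (1 + d_x): index 0 is x,
-- index (suc i) is the neighbour x + S[i]  (d_x = length S).

Idx : ∀ {m} → List (Pt m) → Set
Idx S = Fin (suc (length S))

supp : ∀ {m} (S : List (Pt m)) → Pt m → Idx S → Pt m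
supp S x zero = x
supp S x (suc i) = x ⊕ List.lookup S i

inv : ℕ → ℚ
inv zero = 0ℚ
inv (suc n) = + 1 / suc n

mass : ∀ {m} (S : List (Pt m)) → ℚ → Idx S → ℚ
mass S α zero = α
mass S α (suc i) = (1ℚ ℚ.- α) ℚ.* inv (length S)

sumF : ∀ {n} → (Fin n → ℚ) → ℚ
sumF {zero} f = 0ℚ
sumF {suc n} f = f zero ℚ.+ sumF (λ i → f (suc i))

toℚ : ℕ → ℚ
toℚ n = + n / 1

IsCoupling : ∀ {m} (S : List (Pt m)) → ℚ → (Idx S → Idx S → ℚ) → Set
IsCoupling S α π =
  (∀ i j → 0ℚ ℚ.≤ π i j) ×
  (∀ i → sumF (λ j → π i j) ≡ mass S α i) ×
  (∀ j → sumF (λ i → π i j) ≡ mass S α j)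

DistMatrix : ∀ {m} (S : List (Pt m)) → Pt m → Pt m → (Idx S → Idx S → ℕ) → Set
DistMatrix S x y D = ∀ i j → IsDist S (supp S x i) (supp S y j) (D i j)

cost : ∀ {m} {S : List (Pt m)} → (Idx S → Idx S → ℚ) → (Idx S → Idx S → ℕ) → ℚ
cost π D = sumF (λ i → sumF (λ j → π i j ℚ.* toℚ (D i j)))

-- κ(x,y) = lim_{α→1⁻} κ_α(x,y)/(1-α) = 0, where κ_α = 1 - W(m_x^α,m_y^α)/d(x,y).
-- |κ_α/(1-α)| ≤ ε  ⟺  d(1 - ε(1-α)) ≤ W ≤ d(1 + ε(1-α)),  and
-- W ≤ c ⟺ some coupling has cost ≤ c (the infimum is attained, at a rational coupling),
-- W ≥ c ⟺ every coupling has cost ≥ c.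
KappaZero : ∀ {m} (S : List (Pt m)) → Pt m → Pt m → Set
KappaZero S x y =
  ∀ (dxy : ℕ) → IsDist S x y dxy →
  ∀ (D : Idx S → Idx S → ℕ) → DistMatrix S x y D →
  ∀ (ε : ℚ) → 0ℚ ℚ.< ε →
  ∃ λ (δ : ℚ) → 0ℚ ℚ.< δ ×
    ∀ (α : ℚ) → 1ℚ ℚ.- δ ℚ.< α → α ℚ.< 1ℚ →
      (∃ λ π → IsCoupling S α π ×
         cost {S = S} π D ℚ.≤ toℚ dxy ℚ.* (1ℚ ℚ.+ ε ℚ.* (1ℚ ℚ.- α))) ×
      (∀ π → IsCoupling S α π →
         toℚ dxy ℚ.* (1ℚ ℚ.- ε ℚ.* (1ℚ ℚ.- α)) ℚ.≤ cost {S = S} π D)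

RicciFlat : ∀ {m} → (Pt m → Set) → List (Pt m) → Set
RicciFlat P S = ∀ x → InLattice P x → ∀ s → s ∈ S → KappaZero S x (x ⊕ s)

-- Fix an edge x ~ x + s and put f = ⟨·, s⟩. Outside G₂, any two roots satisfy ⟨r, s⟩ ≤ ⟨s, s⟩:
-- by AM–GM when |r| ≤ |s|, and by a coordinatewise estimate for the long/short pairs of B_n, C_n
-- and F₄. So f grows by at most ⟨s, s⟩ along every edge of Cayley(G, S) and by exactly ⟨s, s⟩
-- from x to x + s; hence d(x, x + s) = 1, and integrating f against a coupling of m_x^α and
-- m_{x+s}^α shows that every coupling costs at least 1 (weak Kantorovich duality), while
-- translating by s costs exactly 1. Thus W(m_x^α, m_{x+s}^α) = d(x, x + s) for every α, and
-- κ_α(x, x + s) = 0.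

module Submission where

open import Defs
open import Data.Nat as ℕ using (ℕ; zero; suc; z≤n; s≤s)
import Data.Nat.Properties as ℕP
open import Data.Integer as ℤ using (ℤ; +_; -1ℤ; ∣_∣)
import Data.Integer.Properties as ℤP
open import Data.Integer.Tactic.RingSolver using (solve-∀)
open import Algebra.Properties.CommutativeSemigroup ℤP.+-commutativeSemigroup using (interchange)
open import Data.Fin using (Fin; zero; suc)
open import Data.Fin.Properties using (_≟_)
open import Data.Vec using ([]; _∷_; lookup)
open import Data.List as List using (List; _∷_; length)
open import Data.List.Membership.Propositional using (_∈_)
open import Data.List.Relation.Unary.Unique.Propositional using (Unique)
import Data.Vec.Properties as VP
open import Data.Product using (∃; _×_; _,_; proj₁)
open import Data.Sum using (inj₁; inj₂)
open import Data.Empty using (⊥-elim)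
open import Relation.Nullary using (yes; no)
open import Relation.Nullary.Decidable using (True; toWitness)
open import Relation.Binary.PropositionalEquality
open import Data.Rational as ℚ using (ℚ; 0ℚ; 1ℚ; _/_)
import Data.Rational.Properties as ℚP
import Data.Rational.Unnormalised as ℚᵘ
import Data.Rational.Unnormalised.Properties as ℚᵘP
open import Algebra.Bundles using (CommutativeRing)
open import Algebra.Properties.AbelianGroup ℚP.+-0-abelianGroup using (xyx⁻¹≈y)
open import Algebra.Properties.CommutativeSemigroup
  (CommutativeRing.*-commutativeSemigroup ℚP.+-*-commutativeRing) using (x∙yz≈y∙xz)
open import Algebra.Properties.Semiring.Sum (CommutativeRing.semiring ℚP.+-*-commutativeRing)
  using (sum; sum-cong-≗; sum-replicate-zero; ∑-distrib-+; ∑-comm; *-distribʳ-sum)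

dot-⊕ˡ : ∀ {m} (u v w : Pt m) → dot (u ⊕ v) w ≡ dot u w ℤ.+ dot v w
dot-⊕ˡ [] [] [] = refl
dot-⊕ˡ (a ∷ u) (b ∷ v) (c ∷ w) rewrite dot-⊕ˡ u v w =
  trans (cong (ℤ._+ _) (ℤP.*-distribʳ-+ c a b)) (interchange (a ℤ.* c) (b ℤ.* c) (dot u w) (dot v w))

dot-·ˡ : ∀ {m} (k : ℤ) (u v : Pt m) → dot (k · u) v ≡ k ℤ.* dot u v
dot-·ˡ k [] [] = sym (ℤP.*-zeroʳ k)
dot-·ˡ k (a ∷ u) (c ∷ v) rewrite dot-·ˡ k u v =
  trans (cong (ℤ._+ _) (ℤP.*-assoc k a c)) (sym (ℤP.*-distribˡ-+ k _ _))

dot-comm : ∀ {m} (u v : Pt m) → dot u v ≡ dot v u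
dot-comm [] [] = refl
dot-comm (a ∷ u) (c ∷ v) = cong₂ ℤ._+_ (ℤP.*-comm a c) (dot-comm u v)

dot-𝟎ˡ : ∀ {m} (v : Pt m) → dot 𝟎 v ≡ + 0
dot-𝟎ˡ [] = refl
dot-𝟎ˡ (c ∷ v) = trans (ℤP.+-identityˡ _) (dot-𝟎ˡ v)

dot-eˡ : ∀ {m} (i : Fin m) (v : Pt m) → dot (e i) v ≡ lookup v i
dot-eˡ zero (c ∷ v) rewrite dot-𝟎ˡ v = trans (ℤP.+-identityʳ _) (ℤP.*-identityˡ c)
dot-eˡ (suc i) (c ∷ v) = trans (ℤP.+-identityˡ _) (dot-eˡ i v)

dot-·eˡ : ∀ {m} (a : ℤ) (i : Fin m) (v : Pt m) → dot (a · e i) v ≡ a ℤ.* lookup v i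
dot-·eˡ a i v = trans (dot-·ˡ a (e i) v) (cong (a ℤ.*_) (dot-eˡ i v))

lookup-⊕ : ∀ {m} (u v : Pt m) (p : Fin m) → lookup (u ⊕ v) p ≡ lookup u p ℤ.+ lookup v p
lookup-⊕ u v p = VP.lookup-zipWith ℤ._+_ p u v

lookup-e-≡ : ∀ {m} (i : Fin m) → lookup (e i) i ≡ + 1
lookup-e-≡ zero = refl
lookup-e-≡ (suc i) = lookup-e-≡ i

lookup-e-≢ : ∀ {m} {i j : Fin m} → i ≢ j → lookup (e i) j ≡ + 0
lookup-e-≢ {i = zero} {zero} i≢j = ⊥-elim (i≢j refl)
lookup-e-≢ {i = zero} {suc j} _ = VP.lookup-replicate j _
lookup-e-≢ {i = suc i} {zero} _ = refl
lookup-e-≢ {i = suc i} {suc j} i≢j = lookup-e-≢ (λ i≡j → i≢j (cong suc i≡j))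

lookup-·e-≡ : ∀ {m} (a : ℤ) (i : Fin m) → lookup (a · e i) i ≡ a
lookup-·e-≡ a i = trans (VP.lookup-map i (a ℤ.*_) (e i))
  (trans (cong (a ℤ.*_) (lookup-e-≡ i)) (ℤP.*-identityʳ a))

lookup-·e-≢ : ∀ {m} (a : ℤ) {i j : Fin m} → i ≢ j → lookup (a · e i) j ≡ + 0
lookup-·e-≢ a {i} {j} i≢j = trans (VP.lookup-map j (a ℤ.*_) (e i))
  (trans (cong (a ℤ.*_) (lookup-e-≢ i≢j)) (ℤP.*-zeroʳ a))

sign-square : ∀ {σ} → IsSign σ → σ ℤ.* σ ≡ + 1
sign-square (inj₁ refl) = refl
sign-square (inj₂ refl) = refl

abs-sign : ∀ {σ} → IsSign σ → ∣ σ ∣ ≡ 1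
abs-sign (inj₁ refl) = refl
abs-sign (inj₂ refl) = refl

abs-signed : ∀ {σ} → IsSign σ → ∀ b → ∣ σ ℤ.* + b ∣ ≡ b
abs-signed {σ} σ± b = trans (ℤP.abs-* σ (+ b)) (trans (cong (ℕ._* b) (abs-sign σ±)) (ℕP.*-identityˡ b))

signed-square : ∀ {σ} → IsSign σ → ∀ c → (σ ℤ.* c) ℤ.* (σ ℤ.* c) ≡ c ℤ.* c
signed-square {σ} σ± c = begin
  (σ ℤ.* c) ℤ.* (σ ℤ.* c) ≡⟨ regroup σ c ⟩
  (σ ℤ.* σ) ℤ.* (c ℤ.* c) ≡⟨ cong (ℤ._* (c ℤ.* c)) (sign-square σ±) ⟩
  + 1 ℤ.* (c ℤ.* c)       ≡⟨ ℤP.*-identityˡ (c ℤ.* c) ⟩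
  c ℤ.* c                 ∎
  where
  open ≡-Reasoning
  regroup : ∀ σ c → (σ ℤ.* c) ℤ.* (σ ℤ.* c) ≡ (σ ℤ.* σ) ℤ.* (c ℤ.* c)
  regroup = solve-∀

i≤∣i∣ : ∀ i → i ℤ.≤ + ∣ i ∣
i≤∣i∣ (+ n) = ℤP.≤-refl
i≤∣i∣ ℤ.-[1+ n ] = ℤ.-≤+

sign*i≤∣i∣ : ∀ {σ} → IsSign σ → ∀ x → σ ℤ.* x ℤ.≤ + ∣ x ∣
sign*i≤∣i∣ (inj₁ refl) x = subst (ℤ._≤ + ∣ x ∣) (sym (ℤP.*-identityˡ x)) (i≤∣i∣ x)
sign*i≤∣i∣ (inj₂ refl) x =
  subst₂ ℤ._≤_ (sym (ℤP.-1*i≡-i x)) (cong +_ (ℤP.∣-i∣≡∣i∣ x)) (i≤∣i∣ (ℤ.- x))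

square-nonNeg : ∀ i → ℤ.NonNegative (i ℤ.* i)
square-nonNeg (+ zero) = _
square-nonNeg ℤ.+[1+ n ] = _
square-nonNeg ℤ.-[1+ n ] = _

*-amgm : ∀ a b → a ℤ.* b ℤ.+ a ℤ.* b ℤ.≤ a ℤ.* a ℤ.+ b ℤ.* b
*-amgm a b = subst (a ℤ.* b ℤ.+ a ℤ.* b ℤ.≤_) (complete-square a b)
  (ℤP.i≤i+j (a ℤ.* b ℤ.+ a ℤ.* b) ((a ℤ.- b) ℤ.* (a ℤ.- b)) {{square-nonNeg (a ℤ.- b)}})
  where
  complete-square : ∀ a b → a ℤ.* b ℤ.+ a ℤ.* b ℤ.+ (a ℤ.- b) ℤ.* (a ℤ.- b) ≡ a ℤ.* a ℤ.+ b ℤ.* b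
  complete-square = solve-∀

dot-amgm : ∀ {m} (r s : Pt m) → dot r s ℤ.+ dot r s ℤ.≤ dot r r ℤ.+ dot s s
dot-amgm [] [] = ℤP.≤-refl
dot-amgm (a ∷ r) (b ∷ s) = subst₂ ℤ._≤_
  (sym (interchange (a ℤ.* b) (dot r s) (a ℤ.* b) (dot r s)))
  (sym (interchange (a ℤ.* a) (dot r r) (b ℤ.* b) (dot s s)))
  (ℤP.+-mono-≤ (*-amgm a b) (dot-amgm r s))

i+i≤j+j⇒i≤j : ∀ {i j} → i ℤ.+ i ℤ.≤ j ℤ.+ j → i ℤ.≤ j
i+i≤j+j⇒i≤j i+i≤j+j = ℤP.≮⇒≥ (λ j<i → ℤP.≤⇒≯ i+i≤j+j (ℤP.+-mono-< j<i j<i))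

pairing≤norm : ∀ {m} {r s : Pt m} → dot r r ℤ.≤ dot s s → dot r s ℤ.≤ dot s s
pairing≤norm {r = r} {s} ∣r∣≤∣s∣ =
  i+i≤j+j⇒i≤j (ℤP.≤-trans (dot-amgm r s) (ℤP.+-monoˡ-≤ (dot s s) ∣r∣≤∣s∣))

-- Pairings of roots

norm-oneTerm : ∀ {m c} {s : Pt m} → OneTerm c s → dot s s ≡ c ℤ.* c
norm-oneTerm {c = c} (i , σ , σ± , refl) = begin
  dot (a · e i) (a · e i) ≡⟨ dot-·eˡ a i (a · e i) ⟩
  a ℤ.* lookup (a · e i) i ≡⟨ cong (a ℤ.*_) (lookup-·e-≡ a i) ⟩
  a ℤ.* a                  ≡⟨ signed-square σ± c ⟩
  c ℤ.* c                  ∎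
  where
  open ≡-Reasoning
  a = σ ℤ.* c

norm-twoTerm : ∀ {m c} {s : Pt m} → TwoTerm c s → dot s s ≡ c ℤ.* c ℤ.+ c ℤ.* c
norm-twoTerm {c = c} (i , j , i≢j , σ , τ , σ± , τ± , refl) = begin
  dot (A ⊕ B) v                                 ≡⟨ dot-⊕ˡ A B v ⟩
  dot A v ℤ.+ dot B v                           ≡⟨ cong₂ ℤ._+_ (dot-·eˡ a i v) (dot-·eˡ b j v) ⟩
  a ℤ.* lookup v i ℤ.+ b ℤ.* lookup v j         ≡⟨ cong₂ (λ x y → a ℤ.* x ℤ.+ b ℤ.* y) v[i]≡a v[j]≡b ⟩
  a ℤ.* a ℤ.+ b ℤ.* b                           ≡⟨ cong₂ ℤ._+_ (signed-square σ± c) (signed-square τ± c) ⟩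
  c ℤ.* c ℤ.+ c ℤ.* c                           ∎
  where
  open ≡-Reasoning
  a = σ ℤ.* c
  b = τ ℤ.* c
  A = a · e i
  B = b · e j
  v = A ⊕ B
  v[i]≡a : lookup v i ≡ a
  v[i]≡a = trans (lookup-⊕ A B i)
    (trans (cong₂ ℤ._+_ (lookup-·e-≡ a i) (lookup-·e-≢ b (λ j≡i → i≢j (sym j≡i)))) (ℤP.+-identityʳ a))
  v[j]≡b : lookup v j ≡ b
  v[j]≡b = trans (lookup-⊕ A B j)
    (trans (cong₂ ℤ._+_ (lookup-·e-≢ a i≢j) (lookup-·e-≡ b j)) (ℤP.+-identityˡ b))

norm-allSigns : ∀ {m} (s : Pt m) → AllSigns s → dot s s ≡ + m
norm-allSigns [] s± = refl
norm-allSigns (x ∷ s) s± = cong₂ ℤ._+_ (sign-square (s± zero)) (norm-allSigns s (λ k → s± (suc k)))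

Aroot-twoTerm : ∀ {m} {i j : Fin m} → i ≢ j → TwoTerm (+ 1) (e i ⊕ (⊖ e j))
Aroot-twoTerm {i = i} {j} i≢j = i , j , i≢j , + 1 , -1ℤ , inj₁ refl , inj₂ refl ,
  cong₂ _⊕_ (sym (trans (VP.map-cong ℤP.*-identityˡ (e i)) (VP.map-id (e i))))
            (VP.map-cong (λ x → sym (ℤP.-1*i≡-i x)) (e j))

norm-Aroot : ∀ {n} {s : Pt (dim (Aₙ n))} → IsRoot (Aₙ n) s → dot s s ≡ + 2
norm-Aroot (i , j , i≢j , refl) = norm-twoTerm (Aroot-twoTerm i≢j)

norm-E8root : ∀ {s} → IsRootE8 s → dot s s ≡ + 8
norm-E8root (inj₁ s∈) = norm-twoTerm s∈
norm-E8root {s} (inj₂ (s± , _)) = norm-allSigns s s±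

PairBound : ∀ {m} → Pt m → ℕ → Set
PairBound {m} s b = ∀ (i j : Fin m) → i ≢ j → ∣ lookup s i ∣ ℕ.+ ∣ lookup s j ∣ ℕ.≤ b

oneTerm-pairBound : ∀ {m b} {s : Pt m} → OneTerm (+ b) s → PairBound s b
oneTerm-pairBound {b = b} (k , ρ , ρ± , refl) i j i≢j with k ≟ i | k ≟ j
... | yes refl | yes refl = ⊥-elim (i≢j refl)
... | yes refl | no k≢j
  rewrite lookup-·e-≡ (ρ ℤ.* + b) k | lookup-·e-≢ (ρ ℤ.* + b) k≢j | abs-signed ρ± b =
    ℕP.≤-reflexive (ℕP.+-identityʳ b)
... | no k≢i | yes refl
  rewrite lookup-·e-≢ (ρ ℤ.* + b) k≢i | lookup-·e-≡ (ρ ℤ.* + b) k | abs-signed ρ± b = ℕP.≤-refl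
... | no k≢i | no k≢j
  rewrite lookup-·e-≢ (ρ ℤ.* + b) k≢i | lookup-·e-≢ (ρ ℤ.* + b) k≢j = z≤n

allSigns-pairBound : ∀ {m} (s : Pt m) → AllSigns s → PairBound s 2
allSigns-pairBound s s± i j _ = ℕP.≤-reflexive (cong₂ ℕ._+_ (abs-sign (s± i)) (abs-sign (s± j)))

dot-twoTerm≤ : ∀ {m a b} {r s : Pt m} → TwoTerm (+ a) r → PairBound s b → dot r s ℤ.≤ + (a ℕ.* b)
dot-twoTerm≤ {a = a} {b} {s = s} (i , j , i≢j , σ , τ , σ± , τ± , refl) bound = begin
  dot (((σ ℤ.* + a) · e i) ⊕ ((τ ℤ.* + a) · e j)) s
    ≡⟨ dot-⊕ˡ ((σ ℤ.* + a) · e i) ((τ ℤ.* + a) · e j) s ⟩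
  dot ((σ ℤ.* + a) · e i) s ℤ.+ dot ((τ ℤ.* + a) · e j) s
    ≡⟨ cong₂ ℤ._+_ (dot-·eˡ (σ ℤ.* + a) i s) (dot-·eˡ (τ ℤ.* + a) j s) ⟩
  σ ℤ.* + a ℤ.* x ℤ.+ τ ℤ.* + a ℤ.* y
    ≡⟨ factor σ τ (+ a) x y ⟩
  + a ℤ.* (σ ℤ.* x ℤ.+ τ ℤ.* y)
    ≤⟨ ℤP.*-monoˡ-≤-nonNeg (+ a) (ℤP.+-mono-≤ (sign*i≤∣i∣ σ± x) (sign*i≤∣i∣ τ± y)) ⟩
  + a ℤ.* (+ ∣ x ∣ ℤ.+ + ∣ y ∣)
    ≡⟨ ℤP.pos-* a (∣ x ∣ ℕ.+ ∣ y ∣) ⟨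
  + (a ℕ.* (∣ x ∣ ℕ.+ ∣ y ∣))
    ≤⟨ ℤ.+≤+ (ℕP.*-monoʳ-≤ a (bound i j i≢j)) ⟩
  + (a ℕ.* b) ∎
  where
  open ℤP.≤-Reasoning
  x = lookup s i
  y = lookup s j
  factor : ∀ σ τ a x y → σ ℤ.* a ℤ.* x ℤ.+ τ ℤ.* a ℤ.* y ≡ a ℤ.* (σ ℤ.* x ℤ.+ τ ℤ.* y)
  factor = solve-∀

by-norms : ∀ {m} (r s : Pt m) {a b : ℕ} → dot r r ≡ + a → dot s s ≡ + b →
  {True (a ℕ.≤? b)} → dot r s ℤ.≤ dot s s
by-norms r s rr ss {a≤b} = pairing≤norm {r = r} {s} (subst₂ ℤ._≤_ (sym rr) (sym ss) (ℤ.+≤+ (toWitness a≤b)))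

by-bound : ∀ {m} (r s : Pt m) {a b : ℕ} → dot r s ℤ.≤ + a → dot s s ≡ + b →
  {True (a ℕ.≤? b)} → dot r s ℤ.≤ dot s s
by-bound r s rs≤a ss {a≤b} = ℤP.≤-trans rs≤a (subst (+ _ ℤ.≤_) (sym ss) (ℤ.+≤+ (toWitness a≤b)))

root-pairing≤norm : ∀ t (r s : Pt (dim t)) → IsRoot t r → IsRoot t s → dot r s ℤ.≤ dot s s
root-pairing≤norm (Aₙ n) r s r∈ s∈ = by-norms r s (norm-Aroot r∈) (norm-Aroot s∈)
root-pairing≤norm (Bₙ n) r s (inj₁ r∈) (inj₁ s∈) = by-norms r s (norm-oneTerm r∈) (norm-oneTerm s∈)
root-pairing≤norm (Bₙ n) r s (inj₁ r∈) (inj₂ s∈) = by-norms r s (norm-oneTerm r∈) (norm-twoTerm s∈)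
root-pairing≤norm (Bₙ n) r s (inj₂ r∈) (inj₁ s∈) =
  by-bound r s (dot-twoTerm≤ r∈ (oneTerm-pairBound s∈)) (norm-oneTerm s∈)
root-pairing≤norm (Bₙ n) r s (inj₂ r∈) (inj₂ s∈) = by-norms r s (norm-twoTerm r∈) (norm-twoTerm s∈)
root-pairing≤norm (Cₙ n) r s (inj₁ r∈) (inj₁ s∈) = by-norms r s (norm-oneTerm r∈) (norm-oneTerm s∈)
root-pairing≤norm (Cₙ n) r s (inj₁ r∈) (inj₂ s∈) =
  by-bound r s (subst (ℤ._≤ _) (dot-comm s r) (dot-twoTerm≤ s∈ (oneTerm-pairBound r∈))) (norm-twoTerm s∈)
root-pairing≤norm (Cₙ n) r s (inj₂ r∈) (inj₁ s∈) = by-norms r s (norm-twoTerm r∈) (norm-oneTerm s∈)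
root-pairing≤norm (Cₙ n) r s (inj₂ r∈) (inj₂ s∈) = by-norms r s (norm-twoTerm r∈) (norm-twoTerm s∈)
root-pairing≤norm (Dₙ n) r s r∈ s∈ = by-norms r s (norm-twoTerm r∈) (norm-twoTerm s∈)
root-pairing≤norm F4 r s (inj₁ r∈) (inj₁ s∈) = by-norms r s (norm-oneTerm r∈) (norm-oneTerm s∈)
root-pairing≤norm F4 r s (inj₁ r∈) (inj₂ (inj₁ s∈)) = by-norms r s (norm-oneTerm r∈) (norm-twoTerm s∈)
root-pairing≤norm F4 r s (inj₁ r∈) (inj₂ (inj₂ s±)) = by-norms r s (norm-oneTerm r∈) (norm-allSigns s s±)
root-pairing≤norm F4 r s (inj₂ (inj₁ r∈)) (inj₁ s∈) =
  by-bound r s (dot-twoTerm≤ r∈ (oneTerm-pairBound s∈)) (norm-oneTerm s∈)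
root-pairing≤norm F4 r s (inj₂ (inj₁ r∈)) (inj₂ (inj₁ s∈)) = by-norms r s (norm-twoTerm r∈) (norm-twoTerm s∈)
root-pairing≤norm F4 r s (inj₂ (inj₁ r∈)) (inj₂ (inj₂ s±)) =
  by-bound r s (dot-twoTerm≤ r∈ (allSigns-pairBound s s±)) (norm-allSigns s s±)
root-pairing≤norm F4 r s (inj₂ (inj₂ r±)) (inj₁ s∈) = by-norms r s (norm-allSigns r r±) (norm-oneTerm s∈)
root-pairing≤norm F4 r s (inj₂ (inj₂ r±)) (inj₂ (inj₁ s∈)) = by-norms r s (norm-allSigns r r±) (norm-twoTerm s∈)
root-pairing≤norm F4 r s (inj₂ (inj₂ r±)) (inj₂ (inj₂ s±)) = by-norms r s (norm-allSigns r r±) (norm-allSigns s s±)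
root-pairing≤norm E6 r s (r∈ , _) (s∈ , _) = by-norms r s (norm-E8root r∈) (norm-E8root s∈)
root-pairing≤norm E7 r s (r∈ , _) (s∈ , _) = by-norms r s (norm-E8root r∈) (norm-E8root s∈)
root-pairing≤norm E8 r s r∈ s∈ = by-norms r s (norm-E8root r∈) (norm-E8root s∈)

norm-pos : ∀ {m} (s : Pt m) {n} → dot s s ≡ + suc n → + 0 ℤ.< dot s s
norm-pos s ss = subst (+ 0 ℤ.<_) (sym ss) (ℤ.+<+ (s≤s z≤n))

root-norm-pos : ∀ t (s : Pt (dim t)) → IsRoot t s → + 0 ℤ.< dot s s
root-norm-pos (Aₙ n) s s∈ = norm-pos s (norm-Aroot s∈)
root-norm-pos (Bₙ n) s (inj₁ s∈) = norm-pos s (norm-oneTerm s∈)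
root-norm-pos (Bₙ n) s (inj₂ s∈) = norm-pos s (norm-twoTerm s∈)
root-norm-pos (Cₙ n) s (inj₁ s∈) = norm-pos s (norm-oneTerm s∈)
root-norm-pos (Cₙ n) s (inj₂ s∈) = norm-pos s (norm-twoTerm s∈)
root-norm-pos (Dₙ n) s s∈ = norm-pos s (norm-twoTerm s∈)
root-norm-pos F4 s (inj₁ s∈) = norm-pos s (norm-oneTerm s∈)
root-norm-pos F4 s (inj₂ (inj₁ s∈)) = norm-pos s (norm-twoTerm s∈)
root-norm-pos F4 s (inj₂ (inj₂ s±)) = norm-pos s (norm-allSigns s s±)
root-norm-pos E6 s (s∈ , _) = norm-pos s (norm-E8root s∈)
root-norm-pos E7 s (s∈ , _) = norm-pos s (norm-E8root s∈)
root-norm-pos E8 s s∈ = norm-pos s (norm-E8root s∈)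

-- Walks in the Cayley graph

walk-dot≤ : ∀ {m} {S : List (Pt m)} {w : Pt m} {c : ℤ} → (∀ {t} → t ∈ S → dot t w ℤ.≤ c) →
  ∀ {u v k} → Walk S u v k → dot v w ℤ.≤ dot u w ℤ.+ + k ℤ.* c
walk-dot≤ {w = w} bounded {u} here = ℤP.≤-reflexive (sym (ℤP.+-identityʳ (dot u w)))
walk-dot≤ {w = w} {c} bounded {u} {v} {suc k} (step {s = t} t∈S walk) = begin
  dot v w                                   ≤⟨ walk-dot≤ bounded walk ⟩
  dot (u ⊕ t) w ℤ.+ + k ℤ.* c               ≡⟨ cong (ℤ._+ + k ℤ.* c) (dot-⊕ˡ u t w) ⟩
  dot u w ℤ.+ dot t w ℤ.+ + k ℤ.* c         ≤⟨ ℤP.+-monoˡ-≤ (+ k ℤ.* c) (ℤP.+-monoʳ-≤ (dot u w) (bounded t∈S)) ⟩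
  dot u w ℤ.+ c ℤ.+ + k ℤ.* c               ≡⟨ regroup (dot u w) c (+ k) ⟩
  dot u w ℤ.+ + suc k ℤ.* c                 ∎
  where
  open ℤP.≤-Reasoning
  regroup : ∀ x c k → x ℤ.+ c ℤ.+ k ℤ.* c ≡ x ℤ.+ (+ 1 ℤ.+ k) ℤ.* c
  regroup = solve-∀

supp-shift : ∀ {m} (S : List (Pt m)) (x s : Pt m) (j : Idx S) → supp S (x ⊕ s) j ≡ supp S x j ⊕ s
supp-shift S x s zero = refl
supp-shift S x s (suc j) = begin
  (x ⊕ s) ⊕ t ≡⟨ ⊕-assoc x s t ⟩
  x ⊕ (s ⊕ t) ≡⟨ cong (x ⊕_) (VP.zipWith-comm ℤP.+-comm s t) ⟩
  x ⊕ (t ⊕ s) ≡⟨ ⊕-assoc x t s ⟨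
  (x ⊕ t) ⊕ s ∎
  where
  open ≡-Reasoning
  t = List.lookup S j
  ⊕-assoc : ∀ {m} (u v w : Pt m) → (u ⊕ v) ⊕ w ≡ u ⊕ (v ⊕ w)
  ⊕-assoc = VP.zipWith-assoc ℤP.+-assoc

-- Rationals and finite sums

fromℤ : ℤ → ℚ
fromℤ i = i / 1

toℚᵘ-fromℤ : ∀ i → ℚ.toℚᵘ (fromℤ i) ℚᵘ.≃ ℚᵘ.mkℚᵘ i 0
toℚᵘ-fromℤ i = ℚP.toℚᵘ-fromℚᵘ (ℚᵘ.mkℚᵘ i 0)

fromℤ-+ : ∀ i j → fromℤ (i ℤ.+ j) ≡ fromℤ i ℚ.+ fromℤ j
fromℤ-+ i j = ℚP.toℚᵘ-injective (begin
  ℚ.toℚᵘ (fromℤ (i ℤ.+ j))                     ≈⟨ toℚᵘ-fromℤ (i ℤ.+ j) ⟩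
  ℚᵘ.mkℚᵘ (i ℤ.+ j) 0                          ≈⟨ ℚᵘ.*≡* (sum-over-1 i j) ⟩
  ℚᵘ.mkℚᵘ i 0 ℚᵘ.+ ℚᵘ.mkℚᵘ j 0                 ≈⟨ ℚᵘP.+-cong (toℚᵘ-fromℤ i) (toℚᵘ-fromℤ j) ⟨
  ℚ.toℚᵘ (fromℤ i) ℚᵘ.+ ℚ.toℚᵘ (fromℤ j)      ≈⟨ ℚP.toℚᵘ-homo-+ (fromℤ i) (fromℤ j) ⟨
  ℚ.toℚᵘ (fromℤ i ℚ.+ fromℤ j)                 ∎)
  where
  open ℚᵘP.≃-Reasoning
  sum-over-1 : ∀ i j → (i ℤ.+ j) ℤ.* + 1 ≡ (i ℤ.* + 1 ℤ.+ j ℤ.* + 1) ℤ.* + 1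
  sum-over-1 = solve-∀

fromℤ-* : ∀ i j → fromℤ (i ℤ.* j) ≡ fromℤ i ℚ.* fromℤ j
fromℤ-* i j = ℚP.toℚᵘ-injective (begin
  ℚ.toℚᵘ (fromℤ (i ℤ.* j))                     ≈⟨ toℚᵘ-fromℤ (i ℤ.* j) ⟩
  ℚᵘ.mkℚᵘ i 0 ℚᵘ.* ℚᵘ.mkℚᵘ j 0                 ≈⟨ ℚᵘP.*-cong (toℚᵘ-fromℤ i) (toℚᵘ-fromℤ j) ⟨
  ℚ.toℚᵘ (fromℤ i) ℚᵘ.* ℚ.toℚᵘ (fromℤ j)      ≈⟨ ℚP.toℚᵘ-homo-* (fromℤ i) (fromℤ j) ⟨
  ℚ.toℚᵘ (fromℤ i ℚ.* fromℤ j)                 ∎)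
  where open ℚᵘP.≃-Reasoning

fromℤ-mono-≤ : ∀ {i j} → i ℤ.≤ j → fromℤ i ℚ.≤ fromℤ j
fromℤ-mono-≤ {i} {j} i≤j = ℚP.toℚᵘ-cancel-≤
  (ℚᵘP.≤-respʳ-≃ (ℚᵘP.≃-sym (toℚᵘ-fromℤ j)) (ℚᵘP.≤-respˡ-≃ (ℚᵘP.≃-sym (toℚᵘ-fromℤ i))
    (ℚᵘ.*≤* (subst₂ ℤ._≤_ (sym (ℤP.*-identityʳ i)) (sym (ℤP.*-identityʳ j)) i≤j))))

fromℤ-mono-< : ∀ {i j} → i ℤ.< j → fromℤ i ℚ.< fromℤ j
fromℤ-mono-< {i} {j} i<j = ℚP.toℚᵘ-cancel-<
  (ℚᵘP.<-respʳ-≃ (ℚᵘP.≃-sym (toℚᵘ-fromℤ j)) (ℚᵘP.<-respˡ-≃ (ℚᵘP.≃-sym (toℚᵘ-fromℤ i))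
    (ℚᵘ.*<* (subst₂ ℤ._<_ (sym (ℤP.*-identityʳ i)) (sym (ℤP.*-identityʳ j)) i<j))))

*-nonNeg : ∀ {p q} → 0ℚ ℚ.≤ p → 0ℚ ℚ.≤ q → 0ℚ ℚ.≤ p ℚ.* q
*-nonNeg {p} {q} 0≤p 0≤q = ℚP.nonNegative⁻¹ (p ℚ.* q)
  {{ℚP.nonNeg*nonNeg⇒nonNeg p {{ℚ.nonNegative 0≤p}} q {{ℚ.nonNegative 0≤q}}}}

p≤p+q : ∀ p {q} → 0ℚ ℚ.≤ q → p ℚ.≤ p ℚ.+ q
p≤p+q p {q} 0≤q = subst (ℚ._≤ p ℚ.+ q) (ℚP.+-identityʳ p) (ℚP.+-monoʳ-≤ p 0≤q)

p-q≤p : ∀ p {q} → 0ℚ ℚ.≤ q → p ℚ.- q ℚ.≤ p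
p-q≤p p {q} 0≤q = subst (p ℚ.- q ℚ.≤_) (ℚP.+-identityʳ p) (ℚP.+-monoʳ-≤ p (ℚP.neg-antimono-≤ 0≤q))

p≤1⇒0≤1-p : ∀ {p} → p ℚ.≤ 1ℚ → 0ℚ ℚ.≤ 1ℚ ℚ.- p
p≤1⇒0≤1-p {p} p≤1 = subst (ℚ._≤ 1ℚ ℚ.- p) (ℚP.+-inverseʳ 1ℚ) (ℚP.+-monoʳ-≤ 1ℚ (ℚP.neg-antimono-≤ p≤1))

+-cancelˡ-≤ : ∀ a {b c} → a ℚ.+ b ℚ.≤ a ℚ.+ c → b ℚ.≤ c
+-cancelˡ-≤ a {b} {c} a+b≤a+c = subst₂ ℚ._≤_ (cancel b) (cancel c) (ℚP.+-monoʳ-≤ (ℚ.- a) a+b≤a+c)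
  where
  cancel : ∀ x → ℚ.- a ℚ.+ (a ℚ.+ x) ≡ x
  cancel x = trans (ℚP.+-comm (ℚ.- a) (a ℚ.+ x)) (xyx⁻¹≈y a x)

sumF≡sum : ∀ {n} (f : Fin n → ℚ) → sumF f ≡ sum f
sumF≡sum {zero} f = refl
sumF≡sum {suc n} f = cong (f zero ℚ.+_) (sumF≡sum (λ i → f (suc i)))

sum-mono-≤ : ∀ {n} {f g : Fin n → ℚ} → (∀ i → f i ℚ.≤ g i) → sum f ℚ.≤ sum g
sum-mono-≤ {zero} f≤g = ℚP.≤-refl
sum-mono-≤ {suc n} f≤g = ℚP.+-mono-≤ (f≤g zero) (sum-mono-≤ (λ i → f≤g (suc i)))

sum-const : ∀ n (c : ℚ) → sum {n} (λ _ → c) ≡ toℚ n ℚ.* c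
sum-const zero c = sym (ℚP.*-zeroˡ c)
sum-const (suc n) c = begin
  c ℚ.+ sum {n} (λ _ → c)         ≡⟨ cong (c ℚ.+_) (sum-const n c) ⟩
  c ℚ.+ toℚ n ℚ.* c               ≡⟨ cong (ℚ._+ toℚ n ℚ.* c) (ℚP.*-identityˡ c) ⟨
  1ℚ ℚ.* c ℚ.+ toℚ n ℚ.* c        ≡⟨ ℚP.*-distribʳ-+ c 1ℚ (toℚ n) ⟨
  (1ℚ ℚ.+ toℚ n) ℚ.* c            ≡⟨ cong (ℚ._* c) (fromℤ-+ (+ 1) (+ n)) ⟨
  toℚ (suc n) ℚ.* c               ∎
  where open ≡-Reasoning

δ : ∀ {n} → Fin n → Fin n → ℚ
δ zero zero = 1ℚ
δ zero (suc j) = 0ℚ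
δ (suc i) zero = 0ℚ
δ (suc i) (suc j) = δ i j

δ-comm : ∀ {n} (i j : Fin n) → δ i j ≡ δ j i
δ-comm zero zero = refl
δ-comm zero (suc j) = refl
δ-comm (suc i) zero = refl
δ-comm (suc i) (suc j) = δ-comm i j

δ-nonNeg : ∀ {n} (i j : Fin n) → 0ℚ ℚ.≤ δ i j
δ-nonNeg zero zero = ℚP.nonNegative⁻¹ 1ℚ
δ-nonNeg zero (suc j) = ℚP.≤-refl
δ-nonNeg (suc i) zero = ℚP.≤-refl
δ-nonNeg (suc i) (suc j) = δ-nonNeg i j

sum-δ : ∀ {n} (i : Fin n) (f : Fin n → ℚ) → sum (λ j → δ i j ℚ.* f j) ≡ f i
sum-δ {suc n} zero f = begin
  1ℚ ℚ.* f zero ℚ.+ sum (λ j → 0ℚ ℚ.* f (suc j)) ≡⟨ cong₂ ℚ._+_ (ℚP.*-identityˡ (f zero)) rest≡0 ⟩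
  f zero ℚ.+ 0ℚ                                  ≡⟨ ℚP.+-identityʳ (f zero) ⟩
  f zero                                         ∎
  where
  open ≡-Reasoning
  rest≡0 : sum (λ j → 0ℚ ℚ.* f (suc j)) ≡ 0ℚ
  rest≡0 = trans (sum-cong-≗ (λ j → ℚP.*-zeroˡ (f (suc j)))) (sum-replicate-zero n)
sum-δ (suc i) f = trans (cong₂ ℚ._+_ (ℚP.*-zeroˡ (f zero)) (sum-δ i (λ j → f (suc j))))
  (ℚP.+-identityˡ (f (suc i)))

sum-marginal : ∀ {n} {ρ : Fin n → Fin n → ℚ} {μ : Fin n → ℚ} → (∀ i → sum (ρ i) ≡ μ i) →
  ∀ (f : Fin n → ℚ) → sum (λ i → sum (λ j → ρ i j ℚ.* f i)) ≡ sum (λ i → μ i ℚ.* f i)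
sum-marginal {ρ = ρ} marg f =
  sum-cong-≗ (λ i → trans (sym (*-distribʳ-sum (f i) (ρ i))) (cong (ℚ._* f i) (marg i)))

weak-duality : ∀ {n} {π : Fin n → Fin n → ℚ} {μ ν : Fin n → ℚ} →
  (∀ i j → 0ℚ ℚ.≤ π i j) → (∀ i → sum (π i) ≡ μ i) → (∀ j → sum (λ i → π i j) ≡ ν j) →
  ∀ (f g : Fin n → ℚ) (d : Fin n → Fin n → ℚ) (c : ℚ) → (∀ i j → g j ℚ.≤ f i ℚ.+ d i j ℚ.* c) →
  sum (λ j → ν j ℚ.* g j) ℚ.≤ sum (λ i → μ i ℚ.* f i) ℚ.+ sum (λ i → sum (λ j → π i j ℚ.* d i j)) ℚ.* c
weak-duality {π = π} {μ} {ν} π≥0 rows cols f g d c g≤f+dc = begin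
  sum (λ j → ν j ℚ.* g j)
    ≡⟨ sum-marginal cols g ⟨
  sum (λ j → sum (λ i → π i j ℚ.* g j))
    ≡⟨ ∑-comm (λ i j → π i j ℚ.* g j) ⟨
  sum (λ i → sum (λ j → π i j ℚ.* g j))
    ≤⟨ sum-mono-≤ (λ i → sum-mono-≤ (λ j →
         ℚP.*-monoˡ-≤-nonNeg (π i j) {{ℚ.nonNegative (π≥0 i j)}} (g≤f+dc i j))) ⟩
  sum (λ i → sum (λ j → π i j ℚ.* (f i ℚ.+ d i j ℚ.* c)))
    ≡⟨ sum-cong-≗ (λ i → trans (sum-cong-≗ (λ j → distrib (π i j) (f i) (d i j)))
                                (∑-distrib-+ (λ j → π i j ℚ.* f i) (λ j → π i j ℚ.* d i j ℚ.* c))) ⟩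
  sum (λ i → sum (λ j → π i j ℚ.* f i) ℚ.+ sum (λ j → π i j ℚ.* d i j ℚ.* c))
    ≡⟨ ∑-distrib-+ (λ i → sum (λ j → π i j ℚ.* f i))
                   (λ i → sum (λ j → π i j ℚ.* d i j ℚ.* c)) ⟩
  sum (λ i → sum (λ j → π i j ℚ.* f i)) ℚ.+ sum (λ i → sum (λ j → π i j ℚ.* d i j ℚ.* c))
    ≡⟨ cong₂ ℚ._+_ (sum-marginal rows f) factor-c ⟩
  sum (λ i → μ i ℚ.* f i) ℚ.+ sum (λ i → sum (λ j → π i j ℚ.* d i j)) ℚ.* c ∎
  where
  open ℚP.≤-Reasoning
  distrib : ∀ p x y → p ℚ.* (x ℚ.+ y ℚ.* c) ≡ p ℚ.* x ℚ.+ p ℚ.* y ℚ.* c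
  distrib p x y = trans (ℚP.*-distribˡ-+ p x (y ℚ.* c)) (cong (p ℚ.* x ℚ.+_) (sym (ℚP.*-assoc p y c)))
  factor-c : sum (λ i → sum (λ j → π i j ℚ.* d i j ℚ.* c)) ≡ sum (λ i → sum (λ j → π i j ℚ.* d i j)) ℚ.* c
  factor-c = trans (sum-cong-≗ (λ i → sym (*-distribʳ-sum c (λ j → π i j ℚ.* d i j))))
                   (sym (*-distribʳ-sum c (λ i → sum (λ j → π i j ℚ.* d i j))))

-- Transport between the measures m_x^α

inv-nonNeg : ∀ n → 0ℚ ℚ.≤ inv n
inv-nonNeg zero = ℚP.≤-refl
inv-nonNeg (suc n) = ℚP.nonNegative⁻¹ (inv (suc n)) {{ℚP.normalize-nonNeg 1 (suc n)}}

toℚ*inv : ∀ k → toℚ (suc k) ℚ.* inv (suc k) ≡ 1ℚ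
toℚ*inv k = ℚP.toℚᵘ-injective (begin
  ℚ.toℚᵘ (toℚ (suc k) ℚ.* inv (suc k))
    ≈⟨ ℚP.toℚᵘ-homo-* (toℚ (suc k)) (inv (suc k)) ⟩
  ℚ.toℚᵘ (toℚ (suc k)) ℚᵘ.* ℚ.toℚᵘ (inv (suc k))
    ≈⟨ ℚᵘP.*-cong (toℚᵘ-fromℤ (+ suc k)) (ℚP.toℚᵘ-fromℚᵘ (ℚᵘ.mkℚᵘ (+ 1) k)) ⟩
  ℚᵘ.mkℚᵘ (+ suc k) 0 ℚᵘ.* ℚᵘ.mkℚᵘ (+ 1) k
    ≈⟨ ℚᵘP.*-inverseʳ (ℚᵘ.mkℚᵘ (+ suc k) 0) ⟩
  ℚᵘ.1ℚᵘ ∎)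
  where open ℚᵘP.≃-Reasoning

mass-nonNeg : ∀ {m} (S : List (Pt m)) {α} → 0ℚ ℚ.≤ α → α ℚ.≤ 1ℚ → ∀ i → 0ℚ ℚ.≤ mass S α i
mass-nonNeg S 0≤α α≤1 zero = 0≤α
mass-nonNeg S 0≤α α≤1 (suc i) = *-nonNeg (p≤1⇒0≤1-p α≤1) (inv-nonNeg (length S))

sum-mass : ∀ {m} {S : List (Pt m)} {s} → s ∈ S → ∀ α → sum (mass S α) ≡ 1ℚ
sum-mass {S = t ∷ S} _ α = begin
  α ℚ.+ sum {L} (λ _ → (1ℚ ℚ.- α) ℚ.* inv L)  ≡⟨ cong (α ℚ.+_) (sum-const L ((1ℚ ℚ.- α) ℚ.* inv L)) ⟩
  α ℚ.+ toℚ L ℚ.* ((1ℚ ℚ.- α) ℚ.* inv L)      ≡⟨ cong (α ℚ.+_) (x∙yz≈y∙xz (toℚ L) (1ℚ ℚ.- α) (inv L)) ⟩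
  α ℚ.+ (1ℚ ℚ.- α) ℚ.* (toℚ L ℚ.* inv L)      ≡⟨ cong (λ x → α ℚ.+ (1ℚ ℚ.- α) ℚ.* x) (toℚ*inv (length S)) ⟩
  α ℚ.+ (1ℚ ℚ.- α) ℚ.* 1ℚ                     ≡⟨ cong (α ℚ.+_) (ℚP.*-identityʳ (1ℚ ℚ.- α)) ⟩
  α ℚ.+ (1ℚ ℚ.- α)                            ≡⟨ ℚP.+-assoc α 1ℚ (ℚ.- α) ⟨
  α ℚ.+ 1ℚ ℚ.- α                              ≡⟨ xyx⁻¹≈y α 1ℚ ⟩
  1ℚ                                          ∎
  where
  open ≡-Reasoning
  L = length (t ∷ S)

cost≡∑∑ : ∀ {m} (S : List (Pt m)) (π : Idx S → Idx S → ℚ) (D : Idx S → Idx S → ℕ) →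
  cost {S = S} π D ≡ sum (λ i → sum (λ j → π i j ℚ.* toℚ (D i j)))
cost≡∑∑ S π D = trans (sumF≡sum (λ i → sumF (λ j → π i j ℚ.* toℚ (D i j))))
  (sum-cong-≗ (λ i → sumF≡sum (λ j → π i j ℚ.* toℚ (D i j))))

diagonal : ∀ {m} (S : List (Pt m)) → ℚ → Idx S → Idx S → ℚ
diagonal S α i j = δ i j ℚ.* mass S α i

diagonal-isCoupling : ∀ {m} (S : List (Pt m)) {α} → (∀ i → 0ℚ ℚ.≤ mass S α i) →
  IsCoupling S α (diagonal S α)
diagonal-isCoupling S {α} M≥0 =
  (λ i j → *-nonNeg (δ-nonNeg i j) (M≥0 i)) ,
  (λ i → trans (sumF≡sum (diagonal S α i)) (sum-δ i (λ _ → mass S α i))) ,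
  (λ j → trans (sumF≡sum (λ i → diagonal S α i j))
    (trans (sum-cong-≗ (λ i → cong (ℚ._* mass S α i) (δ-comm i j))) (sum-δ j (mass S α))))

cost-diagonal : ∀ {m} (S : List (Pt m)) α (D : Idx S → Idx S → ℕ) → (∀ i → D i i ≡ 1) →
  cost {S = S} (diagonal S α) D ≡ sum (mass S α)
cost-diagonal S α D Dii≡1 = begin
  cost {S = S} (diagonal S α) D
    ≡⟨ cost≡∑∑ S (diagonal S α) D ⟩
  sum (λ i → sum (λ j → δ i j ℚ.* M i ℚ.* toℚ (D i j)))
    ≡⟨ sum-cong-≗ (λ i → trans (sum-cong-≗ (λ j → ℚP.*-assoc (δ i j) (M i) (toℚ (D i j))))
                                (sum-δ i (λ j → M i ℚ.* toℚ (D i j)))) ⟩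
  sum (λ i → M i ℚ.* toℚ (D i i))
    ≡⟨ sum-cong-≗ (λ i → trans (cong (λ k → M i ℚ.* toℚ k) (Dii≡1 i)) (ℚP.*-identityʳ (M i))) ⟩
  sum M ∎
  where
  open ≡-Reasoning
  M = mass S α

coupling-cost≥1 : ∀ {m} (S : List (Pt m)) {α π} (D : Idx S → Idx S → ℕ) →
  sum (mass S α) ≡ 1ℚ → IsCoupling S α π →
  ∀ (f : Idx S → ℚ) {c} → 0ℚ ℚ.< c → (∀ i j → f j ℚ.+ c ℚ.≤ f i ℚ.+ toℚ (D i j) ℚ.* c) →
  1ℚ ℚ.≤ cost {S = S} π D
coupling-cost≥1 S {α} {π} D ΣM≡1 (π≥0 , rows , cols) f {c} 0<c f-lipschitz =
  ℚP.*-cancelʳ-≤-pos c {{ℚ.positive 0<c}}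
    (+-cancelˡ-≤ (sum (λ i → M i ℚ.* f i)) (subst₂ ℚ._≤_ lhs rhs duality))
  where
  M = mass S α
  duality = weak-duality π≥0 (λ i → trans (sym (sumF≡sum (π i))) (rows i))
    (λ j → trans (sym (sumF≡sum (λ i → π i j))) (cols j))
    f (λ j → f j ℚ.+ c) (λ i j → toℚ (D i j)) c f-lipschitz
  lhs : sum (λ j → M j ℚ.* (f j ℚ.+ c)) ≡ sum (λ i → M i ℚ.* f i) ℚ.+ 1ℚ ℚ.* c
  lhs = begin
    sum (λ j → M j ℚ.* (f j ℚ.+ c))
      ≡⟨ sum-cong-≗ (λ j → ℚP.*-distribˡ-+ (M j) (f j) c) ⟩
    sum (λ j → M j ℚ.* f j ℚ.+ M j ℚ.* c)
      ≡⟨ ∑-distrib-+ (λ j → M j ℚ.* f j) (λ j → M j ℚ.* c) ⟩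
    sum (λ j → M j ℚ.* f j) ℚ.+ sum (λ j → M j ℚ.* c)
      ≡⟨ cong (sum (λ j → M j ℚ.* f j) ℚ.+_) (trans (sym (*-distribʳ-sum c M)) (cong (ℚ._* c) ΣM≡1)) ⟩
    sum (λ i → M i ℚ.* f i) ℚ.+ 1ℚ ℚ.* c ∎
    where open ≡-Reasoning
  rhs : sum (λ i → M i ℚ.* f i) ℚ.+ sum (λ i → sum (λ j → π i j ℚ.* toℚ (D i j))) ℚ.* c
      ≡ sum (λ i → M i ℚ.* f i) ℚ.+ cost {S = S} π D ℚ.* c
  rhs = cong (λ x → sum (λ i → M i ℚ.* f i) ℚ.+ x ℚ.* c) (sym (cost≡∑∑ S π D))

OptimalCost : ∀ {m} (S : List (Pt m)) → ℚ → (Idx S → Idx S → ℕ) → ℚ → Set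
OptimalCost S α D w =
  (∃ λ π → IsCoupling S α π × cost {S = S} π D ℚ.≤ w) ×
  (∀ π → IsCoupling S α π → w ℚ.≤ cost {S = S} π D)

cost≡dist⇒KappaZero : ∀ {m} {S : List (Pt m)} {x y : Pt m} →
  (∀ {dxy} → IsDist S x y dxy → ∀ {D} → DistMatrix S x y D →
     ∀ {α} → 0ℚ ℚ.≤ α → α ℚ.≤ 1ℚ → OptimalCost S α D (toℚ dxy)) →
  KappaZero S x y
cost≡dist⇒KappaZero W≡d dxy isDist D dm ε 0<ε = 1ℚ , ℚP.positive⁻¹ 1ℚ , λ α 0<α α<1 →
  let ((π , π-coupling , cost≤d) , d≤cost) = W≡d isDist dm (ℚP.<⇒≤ 0<α) (ℚP.<⇒≤ α<1)
      0≤e = *-nonNeg (ℚP.<⇒≤ 0<ε) (p≤1⇒0≤1-p (ℚP.<⇒≤ α<1))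
      d = toℚ dxy
      instance _ = ℚP.normalize-nonNeg dxy 1
  in (π , π-coupling ,
       ℚP.≤-trans cost≤d (subst (ℚ._≤ d ℚ.* _) (ℚP.*-identityʳ d) (ℚP.*-monoˡ-≤-nonNeg d (p≤p+q 1ℚ 0≤e)))) ,
     λ π′ π′-coupling →
       ℚP.≤-trans (subst (d ℚ.* _ ℚ.≤_) (ℚP.*-identityʳ d) (ℚP.*-monoˡ-≤-nonNeg d (p-q≤p 1ℚ 0≤e)))
                  (d≤cost π′ π′-coupling)

module _ {m} {S : List (Pt m)} {s w : Pt m} (s∈S : s ∈ S)
         (s-maximal : ∀ {t} → t ∈ S → dot t w ℤ.≤ dot s w) (s-positive : + 0 ℤ.< dot s w) where

  dist-step≡1 : ∀ {u d} → IsDist S u (u ⊕ s) d → d ≡ 1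
  dist-step≡1 {u} {zero} (walk , _) =
    ⊥-elim (ℤP.≤⇒≯ (subst (ℤ._≤ dot u w ℤ.+ + 0) (dot-⊕ˡ u s w) (walk-dot≤ s-maximal walk))
                   (ℤP.+-monoʳ-< (dot u w) s-positive))
  dist-step≡1 {d = suc zero} _ = refl
  dist-step≡1 {d = suc (suc d)} (_ , shortest) = ⊥-elim (shortest 1 (s≤s (s≤s z≤n)) (step s∈S here))

  step-optimalCost : ∀ x {α} (D : Idx S → Idx S → ℕ) → 0ℚ ℚ.≤ α → α ℚ.≤ 1ℚ →
    DistMatrix S x (x ⊕ s) D → OptimalCost S α D 1ℚ
  step-optimalCost x {α} D 0≤α α≤1 dists =
    (diagonal S α , diagonal-isCoupling S (mass-nonNeg S 0≤α α≤1) ,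
      ℚP.≤-reflexive (trans (cost-diagonal S α D D-diagonal) (sum-mass s∈S α))) ,
    λ π π-coupling →
      coupling-cost≥1 S D (sum-mass s∈S α) π-coupling f (fromℤ-mono-< s-positive) f-lipschitz
    where
    D-diagonal : ∀ i → D i i ≡ 1
    D-diagonal i =
      dist-step≡1 (subst (λ v → IsDist S (supp S x i) v (D i i)) (supp-shift S x s i) (dists i i))
    f : Idx S → ℚ
    f i = fromℤ (dot (supp S x i) w)
    f-lipschitz : ∀ i j → f j ℚ.+ fromℤ (dot s w) ℚ.≤ f i ℚ.+ toℚ (D i j) ℚ.* fromℤ (dot s w)
    f-lipschitz i j = subst₂ ℚ._≤_
      (trans (cong (λ v → fromℤ (dot v w)) (supp-shift S x s j))
             (trans (cong fromℤ (dot-⊕ˡ (supp S x j) s w)) (fromℤ-+ (dot (supp S x j) w) (dot s w))))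
      (trans (fromℤ-+ (dot (supp S x i) w) (+ D i j ℤ.* dot s w))
             (cong (f i ℚ.+_) (fromℤ-* (+ D i j) (dot s w))))
      (fromℤ-mono-≤ (walk-dot≤ s-maximal (proj₁ (dists i j))))

  step-kappaZero : ∀ x → KappaZero S x (x ⊕ s)
  step-kappaZero x = cost≡dist⇒KappaZero λ isDist {D} dists 0≤α α≤1 →
    subst (λ d → OptimalCost S _ D (toℚ d)) (sym (dist-step≡1 isDist)) (step-optimalCost x D 0≤α α≤1 dists)

theorem3 : (t : RootType) → ValidType t →
    (S : List (Pt (dim t))) → Unique S →
    (∀ {s} → s ∈ S → IsRoot t s) →
    (∀ {s} → s ∈ S → (⊖ s) ∈ S) →
    RicciFlat (IsRoot t) S
theorem3 t _ S _ roots _ x _ s s∈S =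
  step-kappaZero s∈S (λ {r} r∈S → root-pairing≤norm t r s (roots r∈S) (roots s∈S))
                 (root-norm-pos t s (roots s∈S)) x
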